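{- Let $\mathcal{Q}$ be a generalised quadrangle of order $(s,s^2)$ with $s>1$ odd, and let $\mathcal{H}$ be a set of points of $\mathcal{Q}$ such that every line of $\mathcal{Q}$ contains exactly $(s+1)/2$ points of $\mathcal{H}$ (i.e. $\mathcal{H}$ is a hemisystem of the dual quadrangle). Then the geometry $\Gamma$ with point set $\mathcal{H}$, the lines of $\mathcal{Q}$ as lines and incidence inherited from $\mathcal{Q}$ is a partial quadrangle; specifically, any two noncollinear points of $\mathcal{H}$ are both collinear with exactly $(s-1)^2/2$ points of $\mathcal{H}$.
   Context: A generalised quadrangle of order $(s,t)$ has $s+1$ points per line and $t+1$ lines per point. A partial quadrangle is a point-line geometry in which any two points lie on at most one line, there are no triangles, every line has the same number of points, every point lies on the same number of lines, and there is a constant $\mu$ such that every pair of noncollinear points has exactly $\mu$ common neighbours. -}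

module Defs where

open import Data.Nat using (ℕ; suc; _+_; _*_; _∸_; _/_; _%_; _<_)
open import Data.Bool using (Bool; true; false; _∧_; not; T)
open import Data.Fin using (Fin)
open import Data.List using (List; length; filterᵇ)
open import Data.Bool.ListAction using (any)
open import Data.List using (allFin) public
open import Data.Product using (_×_)
open import Relation.Binary.PropositionalEquality using (_≡_; _≢_)
open import Relation.Nullary using (¬_)

count : (n : ℕ) → (Fin n → Bool) → ℕ
count n f = length (filterᵇ f (allFin n))

-- A finite point-line geometry: ambient points Fin np, lines Fin nl,
-- incidence inc, and the point set is the subset `pts` of Fin np.
-- (Lines are all of Fin nl; incidence is inc restricted to pts.)
record Geometry : Set where
  field
    np  : ℕ
    nl  : ℕ
    inc : Fin np → Fin nl → Bool
    pts : Fin np → Bool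

module _ (G : Geometry) where
  open Geometry G

  collinear : Fin np → Fin np → Bool
  collinear p q = any (λ ℓ → inc p ℓ ∧ inc q ℓ) (allFin nl)

  pointsOn : Fin nl → ℕ
  pointsOn ℓ = count np (λ p → pts p ∧ inc p ℓ)

  linesThrough : Fin np → ℕ
  linesThrough p = count nl (λ ℓ → inc p ℓ)

  AtMostOneLine : Set
  AtMostOneLine = ∀ p q ℓ m → pts p ≡ true → pts q ≡ true → p ≢ q →
    inc p ℓ ≡ true → inc q ℓ ≡ true → inc p m ≡ true → inc q m ≡ true → ℓ ≡ m

  Noncollinear : Fin np → Fin np → Set
  Noncollinear p q = p ≢ q × collinear p q ≡ false

  record IsGQ (s t : ℕ) : Set where
    field
      linePoints  : ∀ ℓ → pointsOn ℓ ≡ s + 1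
      pointLines  : ∀ p → pts p ≡ true → linesThrough p ≡ t + 1
      oneLine     : AtMostOneLine
      gqAxiom     : ∀ p ℓ → pts p ≡ true → inc p ℓ ≡ false →
                    count np (λ q → pts q ∧ inc q ℓ ∧ collinear p q) ≡ 1

  record IsPartialQuadrangle (k r μ : ℕ) : Set where
    field
      linePoints  : ∀ ℓ → pointsOn ℓ ≡ k
      pointLines  : ∀ p → pts p ≡ true → linesThrough p ≡ r
      oneLine     : AtMostOneLine
      noTriangle  : ∀ a b c → pts a ≡ true → pts b ≡ true → pts c ≡ true →
                    a ≢ b → b ≢ c → a ≢ c →
                    collinear a b ≡ true → collinear b c ≡ true → collinear a c ≡ true →
                    T (any (λ ℓ → inc a ℓ ∧ inc b ℓ ∧ inc c ℓ) (allFin nl))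
      mu          : ∀ p q → pts p ≡ true → pts q ≡ true → Noncollinear p q →
                    count np (λ z → pts z ∧ collinear z p ∧ collinear z q) ≡ μ

fullGeometry : (np nl : ℕ) → (Fin np → Fin nl → Bool) → Geometry
fullGeometry np nl inc = record { np = np ; nl = nl ; inc = inc ; pts = λ _ → true }

restrictGeometry : (np nl : ℕ) → (Fin np → Fin nl → Bool) → (Fin np → Bool) → Geometry
restrictGeometry np nl inc H = record { np = np ; nl = nl ; inc = inc ; pts = H }

module Submission where

-- Fix noncollinear points p, q of H and let X = {p,q}^⊥: it has t + 1 = s² + 1 points, pairwise
-- noncollinear. For a point z let τ z be the number of points of X collinear with z. Double
-- counting with the quadrangle axiom gives, over the set Z of points collinear with neither p nor q,
-- the size of Z and the sums of τ and τ²; for t = s² they say that τ has mean s + 1 and variance 0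
-- on Z, so every triad has exactly s + 1 centres. Splitting the sums of the indicator of H and of τ
-- over H according to collinearity with p and q gives two linear equations in |X ∩ H| and |Z ∩ H|;
-- since every line meets H in (s + 1)/2 points, eliminating |Z ∩ H| leaves |X ∩ H| = (s − 1)²/2.

open import Defs
open import Data.Bool using (Bool; true; false; _∧_; not; T)
open import Data.Bool.ListAction using (any)
open import Data.Bool.Properties using (T-≡; ∧-conicalˡ; ∧-conicalʳ)
open import Data.Empty using (⊥; ⊥-elim)
open import Data.Fin using (Fin; zero; suc; punchIn; punchOut; _≟_)
open import Data.Fin.Properties using (punchInᵢ≢i; punchIn-punchOut)
open import Data.List using (length; filterᵇ; tabulate)
open import Data.List.Membership.Propositional using (lose)
open import Data.List.Membership.Propositional.Properties using (∈-allFin)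
open import Data.List.Relation.Unary.Any using (satisfied)
open import Data.List.Relation.Unary.Any.Properties using (any⁺; any⁻)
open import Data.Nat using (ℕ; zero; suc; _+_; _*_; _∸_; _/_; _%_; _<_; _≤_; z≤n; s≤s; ∣_-_∣)
open import Data.Nat.DivMod using (m≡m%n+[m/n]*n; m*n/n≡m)
open import Data.Nat.Properties
  using ( +-*-semiring; +-comm; +-assoc; +-identityʳ; *-comm; *-assoc; *-identityˡ; *-identityʳ; *-zeroʳ
        ; +-cancelˡ-≡; +-cancelʳ-≡; +-cancelʳ-≤; *-cancelˡ-≡; +-mono-≤; +-monoʳ-≤; *-monoʳ-≤
        ; ≤-antisym; ≤-total; m≤m+n; 1+n≰n; suc-injective; m≤n⇒∃[o]m+o≡n
        ; ∣m-m+n∣≡n; ∣-∣-comm; ∣m-n∣≡0⇒m≡n; module ≤-Reasoning )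
open import Data.Nat.Tactic.RingSolver using (solve-∀)
open import Algebra.Properties.Semiring.Sum +-*-semiring
  using (sum; sum-syntax; sum-cong-≗; ∑-distrib-+; ∑-comm; *-distribˡ-sum; *-distribʳ-sum; sum-remove)
open import Data.Product using (∃; ∃₂; _×_; _,_; proj₁)
open import Data.Sum using (inj₁; inj₂)
open import Function using (_∘_)
open import Function.Bundles using (Equivalence)
open import Relation.Binary.PropositionalEquality
  using (_≡_; _≢_; refl; sym; trans; cong; cong₂; subst; module ≡-Reasoning)
open import Relation.Nullary using (does; yes; no; contradiction)

⟦_⟧ : Bool → ℕ
⟦ true ⟧  = 1
⟦ false ⟧ = 0

⟦∧⟧ : ∀ a b → ⟦ a ∧ b ⟧ ≡ ⟦ a ⟧ * ⟦ b ⟧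
⟦∧⟧ true  b = sym (+-identityʳ ⟦ b ⟧)
⟦∧⟧ false b = refl

⟦⟧*⟦⟧≡1 : ∀ {a b} → a ≡ true → b ≡ true → ⟦ a ⟧ * ⟦ b ⟧ ≡ 1
⟦⟧*⟦⟧≡1 refl refl = refl

⟦⟧*⟦⟧≡0 : ∀ {a b} → (a ≡ true → b ≡ true → ⊥) → ⟦ a ⟧ * ⟦ b ⟧ ≡ 0
⟦⟧*⟦⟧≡0 {true}  {true}  ¬ab = ⊥-elim (¬ab refl refl)
⟦⟧*⟦⟧≡0 {true}  {false} ¬ab = refl
⟦⟧*⟦⟧≡0 {false} {b}     ¬ab = refl

⟦⟧*⟦⟧≡⟦⟧ : ∀ a → ⟦ a ⟧ * ⟦ a ⟧ ≡ ⟦ a ⟧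
⟦⟧*⟦⟧≡⟦⟧ true  = refl
⟦⟧*⟦⟧≡⟦⟧ false = refl

any-allFin⁺ : ∀ {n} (b : Fin n → Bool) i → b i ≡ true → T (any b (allFin n))
any-allFin⁺ b i bi = any⁺ b (lose (∈-allFin i) (Equivalence.from T-≡ bi))

any-allFin⁻ : ∀ {n} (b : Fin n → Bool) → T (any b (allFin n)) → ∃ λ i → b i ≡ true
any-allFin⁻ {n} b found with satisfied (any⁻ b (allFin n) found)
... | i , bi = i , Equivalence.to T-≡ bi

length-filterᵇ-tabulate : ∀ {A : Set} n (g : Fin n → A) (b : A → Bool) →
  length (filterᵇ b (tabulate g)) ≡ ∑[ i < n ] ⟦ b (g i) ⟧
length-filterᵇ-tabulate zero    g b = refl
length-filterᵇ-tabulate (suc n) g b with b (g zero)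
... | true  = cong suc (length-filterᵇ-tabulate n (g ∘ suc) b)
... | false = length-filterᵇ-tabulate n (g ∘ suc) b

count≡∑ : ∀ n (b : Fin n → Bool) → count n b ≡ ∑[ i < n ] ⟦ b i ⟧
count≡∑ n b = length-filterᵇ-tabulate n (λ i → i) b

∑-const : ∀ n c → ∑[ i < n ] c ≡ n * c
∑-const zero    c = refl
∑-const (suc n) c = cong (c +_) (∑-const n c)

∑-zero : ∀ n (f : Fin n → ℕ) → (∀ i → f i ≡ 0) → ∑[ i < n ] f i ≡ 0
∑-zero n f f≡0 = trans (sum-cong-≗ f≡0) (trans (∑-const n 0) (*-zeroʳ n))

∑-single : ∀ {n} (f : Fin n → ℕ) j → (∀ i → i ≢ j → f i ≡ 0) → ∑[ i < n ] f i ≡ f j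
∑-single {suc n} f j vanish = begin
  sum f                                     ≡⟨ sum-remove {i = j} f ⟩
  f j + ∑[ k < n ] f (punchIn j k)          ≡⟨ cong (f j +_) (∑-zero n _ (λ k → vanish _ (punchInᵢ≢i j k))) ⟩
  f j + 0                                   ≡⟨ +-identityʳ (f j) ⟩
  f j                                       ∎
  where open ≡-Reasoning

∑-mono-≤ : ∀ n {f g : Fin n → ℕ} → (∀ i → f i ≤ g i) → ∑[ i < n ] f i ≤ ∑[ i < n ] g i
∑-mono-≤ zero    f≤g = z≤n
∑-mono-≤ (suc n) f≤g = +-mono-≤ (f≤g zero) (∑-mono-≤ n (f≤g ∘ suc))

∑-≡⇒≗ : ∀ n {f g : Fin n → ℕ} → (∀ i → f i ≤ g i) →
        ∑[ i < n ] f i ≡ ∑[ i < n ] g i → ∀ i → f i ≡ g i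
∑-≡⇒≗ (suc n) {f} {g} f≤g eq = pointwise
  where
  head≡ : f zero ≡ g zero
  head≡ = ≤-antisym (f≤g zero) (+-cancelʳ-≤ (∑[ i < n ] f (suc i)) _ _ (begin
    g zero + ∑[ i < n ] f (suc i) ≤⟨ +-monoʳ-≤ (g zero) (∑-mono-≤ n (f≤g ∘ suc)) ⟩
    g zero + ∑[ i < n ] g (suc i) ≡⟨ sym eq ⟩
    f zero + ∑[ i < n ] f (suc i) ∎))
    where open ≤-Reasoning
  pointwise : ∀ i → f i ≡ g i
  pointwise zero    = head≡
  pointwise (suc i) = ∑-≡⇒≗ n (f≤g ∘ suc) (+-cancelˡ-≡ (f zero) _ _ (trans eq (cong (_+ _) (sym head≡)))) i

f≤∑ : ∀ {n} (f : Fin n → ℕ) i → f i ≤ ∑[ k < n ] f k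
f≤∑ {suc n} f i = subst (f i ≤_) (sym (sum-remove {i = i} f)) (m≤m+n (f i) _)

f+f≤∑ : ∀ {n} (f : Fin n → ℕ) {i j} → i ≢ j → f i + f j ≤ ∑[ k < n ] f k
f+f≤∑ {suc n} f {i} {j} i≢j = begin
  f i + f j                               ≡⟨ cong (λ k → f i + f k) (sym (punchIn-punchOut i≢j)) ⟩
  f i + f (punchIn i (punchOut i≢j))      ≤⟨ +-monoʳ-≤ (f i) (f≤∑ (f ∘ punchIn i) (punchOut i≢j)) ⟩
  f i + ∑[ k < n ] f (punchIn i k)        ≡⟨ sym (sum-remove {i = i} f) ⟩
  sum f                                   ∎
  where open ≤-Reasoning

∑⟦⟧-positive : ∀ n (b : Fin n → Bool) → 0 < ∑[ i < n ] ⟦ b i ⟧ → ∃ λ i → b i ≡ true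
∑⟦⟧-positive (suc n) b positive with b zero in b0
... | true  = zero , b0
... | false with ∑⟦⟧-positive n (b ∘ suc) positive
...   | i , bi = suc i , bi

∑-restricted-cong : ∀ n (b : Fin n → Bool) {f g : Fin n → ℕ} →
  (∀ i → b i ≡ true → f i ≡ g i) → ∑[ i < n ] (⟦ b i ⟧ * f i) ≡ ∑[ i < n ] (⟦ b i ⟧ * g i)
∑-restricted-cong n b {f} {g} f≡g = sum-cong-≗ on-b
  where
  on-b : ∀ i → ⟦ b i ⟧ * f i ≡ ⟦ b i ⟧ * g i
  on-b i with b i in bi
  ... | true  = cong (_+ 0) (f≡g i bi)
  ... | false = refl

∑-restricted-const : ∀ n (b : Fin n → Bool) (f : Fin n → ℕ) c →
  (∀ i → b i ≡ true → f i ≡ c) → ∑[ i < n ] (⟦ b i ⟧ * f i) ≡ ∑[ i < n ] ⟦ b i ⟧ * c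
∑-restricted-const n b f c f≡c = trans (∑-restricted-cong n b f≡c) (sym (*-distribʳ-sum c (λ i → ⟦ b i ⟧)))

⟦⟧-inclusion-exclusion : ∀ a b → ∀ f → ⟦ not a ∧ not b ⟧ * f + ⟦ a ⟧ * f + ⟦ b ⟧ * f ≡ f + ⟦ a ∧ b ⟧ * f
⟦⟧-inclusion-exclusion true  true  = solve-∀
⟦⟧-inclusion-exclusion true  false = solve-∀
⟦⟧-inclusion-exclusion false true  = solve-∀
⟦⟧-inclusion-exclusion false false = solve-∀

∑-restricted-except : ∀ {n} (b : Fin n → Bool) (f : Fin n → ℕ) {m y} j →
  ∑[ i < n ] ⟦ b i ⟧ ≡ m + 1 → b j ≡ true → (∀ i → b i ≡ true → i ≢ j → f i ≡ y) →
  ∑[ i < n ] (⟦ b i ⟧ * f i) ≡ f j + m * y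
∑-restricted-except {suc n} b f {m} {y} j size bj f≡y = begin
  ∑[ i < suc n ] (⟦ b i ⟧ * f i)                          ≡⟨ sum-remove {i = j} (λ i → ⟦ b i ⟧ * f i) ⟩
  ⟦ b j ⟧ * f j + ∑[ k < n ] (⟦ b (j′ k) ⟧ * f (j′ k))    ≡⟨ cong₂ _+_ (cong (λ x → ⟦ x ⟧ * f j) bj)
                                                             (∑-restricted-const n (b ∘ j′) (f ∘ j′) y
                                                               (λ k bk → f≡y (j′ k) bk (punchInᵢ≢i j k))) ⟩
  1 * f j + ∑[ k < n ] ⟦ b (j′ k) ⟧ * y               ≡⟨ cong₂ _+_ (*-identityˡ (f j)) (cong (_* y) rest) ⟩
  f j + m * y                                           ∎
  where
  open ≡-Reasoning
  j′ = punchIn j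
  rest : ∑[ k < n ] ⟦ b (j′ k) ⟧ ≡ m
  rest = suc-injective (begin
    1 + ∑[ k < n ] ⟦ b (j′ k) ⟧         ≡⟨ cong (λ x → ⟦ x ⟧ + ∑[ k < n ] ⟦ b (j′ k) ⟧) bj ⟨
    ⟦ b j ⟧ + ∑[ k < n ] ⟦ b (j′ k) ⟧   ≡⟨ sum-remove {i = j} (λ i → ⟦ b i ⟧) ⟨
    ∑[ i < suc n ] ⟦ b i ⟧              ≡⟨ size ⟩
    m + 1                               ≡⟨ +-comm m 1 ⟩
    suc m                               ∎)

a*a+c*c≡2*c*a+∣a-c∣*∣a-c∣ : ∀ a c → a * a + c * c ≡ 2 * c * a + ∣ a - c ∣ * ∣ a - c ∣
a*a+c*c≡2*c*a+∣a-c∣*∣a-c∣ a c with ≤-total a c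
... | inj₁ a≤c with m≤n⇒∃[o]m+o≡n a≤c
...   | d , refl = trans (left a d) (cong (λ x → 2 * (a + d) * a + x * x) (sym (∣m-m+n∣≡n a d)))
  where
  left : ∀ a d → a * a + (a + d) * (a + d) ≡ 2 * (a + d) * a + d * d
  left = solve-∀
a*a+c*c≡2*c*a+∣a-c∣*∣a-c∣ a c | inj₂ c≤a with m≤n⇒∃[o]m+o≡n c≤a
...   | d , refl = trans (right c d) (cong (λ x → 2 * c * (c + d) + x * x)
                     (sym (trans (∣-∣-comm (c + d) c) (∣m-m+n∣≡n c d))))
  where
  right : ∀ c d → (c + d) * (c + d) + c * c ≡ 2 * c * (c + d) + d * d
  right = solve-∀

a*a+c*c≡2*c*a⇒a≡c : ∀ a c → a * a + c * c ≡ 2 * c * a → a ≡ c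
a*a+c*c≡2*c*a⇒a≡c a c eq = ∣m-n∣≡0⇒m≡n (square≡0 (+-cancelˡ-≡ (2 * c * a) _ _ (begin
  2 * c * a + ∣ a - c ∣ * ∣ a - c ∣  ≡⟨ a*a+c*c≡2*c*a+∣a-c∣*∣a-c∣ a c ⟨
  a * a + c * c                      ≡⟨ eq ⟩
  2 * c * a                          ≡⟨ +-identityʳ _ ⟨
  2 * c * a + 0                      ∎)))
  where
  open ≡-Reasoning
  square≡0 : ∀ {d} → d * d ≡ 0 → d ≡ 0
  square≡0 {zero} _ = refl

2*c*a≤a*a+c*c : ∀ a c → 2 * c * a ≤ a * a + c * c
2*c*a≤a*a+c*c a c = subst (2 * c * a ≤_) (sym (a*a+c*c≡2*c*a+∣a-c∣*∣a-c∣ a c)) (m≤m+n _ _)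

-- (s + 1) times the first equation minus the second eliminates x.
linear-elimination : ∀ s t x h a b c d →
  x + a ≡ b + h → (s + 1) * x + c + t * h ≡ d + h → (s + t) * h + ((s + 1) * b + c) ≡ d + (s + 1) * a
linear-elimination s t x h a b c d e₁ e₂ = +-cancelʳ-≡ h _ _ (begin
  (s + t) * h + ((s + 1) * b + c) + h   ≡⟨ regroup₁ s t h b c ⟩
  (s + 1) * (b + h) + c + t * h         ≡⟨ cong (λ y → (s + 1) * y + c + t * h) e₁ ⟨
  (s + 1) * (x + a) + c + t * h         ≡⟨ regroup₂ s t x a c h ⟩
  (s + 1) * x + c + t * h + (s + 1) * a ≡⟨ cong (_+ (s + 1) * a) e₂ ⟩
  d + h + (s + 1) * a                   ≡⟨ regroup₃ d h s a ⟩
  d + (s + 1) * a + h                   ∎)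
  where
  open ≡-Reasoning
  regroup₁ : ∀ s t h b c → (s + t) * h + ((s + 1) * b + c) + h ≡ (s + 1) * (b + h) + c + t * h
  regroup₁ = solve-∀
  regroup₂ : ∀ s t x a c h → (s + 1) * (x + a) + c + t * h ≡ (s + 1) * x + c + t * h + (s + 1) * a
  regroup₂ = solve-∀
  regroup₃ : ∀ d h s a → d + h + (s + 1) * a ≡ d + (s + 1) * a + h
  regroup₃ = solve-∀

-- The hypothesis says that the sum over b of (f i − c)² vanishes.
zero-variance⇒constant : ∀ n (b : Fin n → Bool) (f : Fin n → ℕ) c →
  ∑[ i < n ] (⟦ b i ⟧ * (f i * f i)) + c * c * ∑[ i < n ] ⟦ b i ⟧ ≡ 2 * c * ∑[ i < n ] (⟦ b i ⟧ * f i) →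
  ∀ i → b i ≡ true → f i ≡ c
zero-variance⇒constant n b f c eq i bi = a*a+c*c≡2*c*a⇒a≡c (f i) c (sym (begin
  2 * c * f i              ≡⟨ *-identityˡ _ ⟨
  1 * (2 * c * f i)        ≡⟨ cong (λ x → ⟦ x ⟧ * (2 * c * f i)) bi ⟨
  lower i                  ≡⟨ ∑-≡⇒≗ n (λ j → *-monoʳ-≤ ⟦ b j ⟧ (2*c*a≤a*a+c*c (f j) c)) ∑lower≡∑upper i ⟩
  upper i                  ≡⟨ cong (λ x → ⟦ x ⟧ * (f i * f i + c * c)) bi ⟩
  1 * (f i * f i + c * c)  ≡⟨ *-identityˡ _ ⟩
  f i * f i + c * c        ∎))
  where
  open ≡-Reasoning
  lower upper : Fin n → ℕ
  lower j = ⟦ b j ⟧ * (2 * c * f j)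
  upper j = ⟦ b j ⟧ * (f j * f j + c * c)
  ∑lower≡∑upper : ∑[ j < n ] lower j ≡ ∑[ j < n ] upper j
  ∑lower≡∑upper = begin
    ∑[ j < n ] lower j                                                 ≡⟨ sum-cong-≗ (λ j → swap ⟦ b j ⟧ (2 * c) (f j)) ⟩
    ∑[ j < n ] (2 * c * (⟦ b j ⟧ * f j))                               ≡⟨ *-distribˡ-sum {n} (2 * c) _ ⟨
    2 * c * ∑[ j < n ] (⟦ b j ⟧ * f j)                                 ≡⟨ eq ⟨
    ∑[ j < n ] (⟦ b j ⟧ * (f j * f j)) + c * c * ∑[ j < n ] ⟦ b j ⟧    ≡⟨ cong (∑[ j < n ] (⟦ b j ⟧ * (f j * f j)) +_) (*-distribˡ-sum {n} (c * c) _) ⟩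
    ∑[ j < n ] (⟦ b j ⟧ * (f j * f j)) + ∑[ j < n ] (c * c * ⟦ b j ⟧)  ≡⟨ ∑-distrib-+ {n} _ _ ⟨
    ∑[ j < n ] (⟦ b j ⟧ * (f j * f j) + c * c * ⟦ b j ⟧)               ≡⟨ sum-cong-≗ (λ j → distrib-indicator ⟦ b j ⟧ (f j * f j) (c * c)) ⟩
    ∑[ j < n ] upper j                                                 ∎
    where
    swap : ∀ x y z → x * (y * z) ≡ y * (x * z)
    swap = solve-∀
    distrib-indicator : ∀ x y z → x * y + z * x ≡ x * (y + z)
    distrib-indicator = solve-∀

-- Counting in a generalised quadrangle of order (s, t)

module Quadrangle {s t N L : ℕ} {inc : Fin N → Fin L → Bool}
                  (gq : IsGQ (fullGeometry N L inc) s t) where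
  open IsGQ gq

  _∼_ : Fin N → Fin N → Bool
  _∼_ = collinear (fullGeometry N L inc)

  I : Fin N → Fin L → ℕ
  I z ℓ = ⟦ inc z ℓ ⟧

  -- C is reflexive (∼-refl): a point counts as collinear with itself.
  C : Fin N → Fin N → ℕ
  C z w = ⟦ z ∼ w ⟧

  δ : Fin N → Fin N → ℕ
  δ z w = ⟦ does (z ≟ w) ⟧

  δ-refl : ∀ z → δ z z ≡ 1
  δ-refl z with z ≟ z
  ... | yes _   = refl
  ... | no  z≢z = ⊥-elim (z≢z refl)

  δ-≢ : ∀ {z w} → z ≢ w → δ z w ≡ 0
  δ-≢ {z} {w} z≢w with z ≟ w
  ... | yes z≡w = ⊥-elim (z≢w z≡w)
  ... | no  _   = refl

  ∼-intro : ∀ {z w ℓ} → inc z ℓ ≡ true → inc w ℓ ≡ true → z ∼ w ≡ true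
  ∼-intro {z} {w} {ℓ} zℓ wℓ = Equivalence.to T-≡ (any-allFin⁺ (λ m → inc z m ∧ inc w m) ℓ (cong₂ _∧_ zℓ wℓ))

  ∼-elim : ∀ {z w} → z ∼ w ≡ true → ∃ λ ℓ → inc z ℓ ≡ true × inc w ℓ ≡ true
  ∼-elim {z} {w} z∼w with any-allFin⁻ (λ m → inc z m ∧ inc w m) (Equivalence.from T-≡ z∼w)
  ... | ℓ , zwℓ = ℓ , ∧-conicalˡ _ _ zwℓ , ∧-conicalʳ _ _ zwℓ

  ∼-sym : ∀ {z w} → z ∼ w ≡ true → w ∼ z ≡ true
  ∼-sym z∼w with ∼-elim z∼w
  ... | ℓ , zℓ , wℓ = ∼-intro wℓ zℓ

  lines-through : ∀ z → ∑[ ℓ < L ] I z ℓ ≡ t + 1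
  lines-through z = trans (sym (count≡∑ L (inc z))) (pointLines z refl)

  points-on : ∀ ℓ → ∑[ z < N ] I z ℓ ≡ s + 1
  points-on ℓ = trans (sym (count≡∑ N (λ z → inc z ℓ))) (linePoints ℓ)

  line-through-point : ∀ z → ∃ λ ℓ → inc z ℓ ≡ true
  line-through-point z = ∑⟦⟧-positive L (inc z) (subst (0 <_) (sym (trans (lines-through z) (+-comm t 1))) (s≤s z≤n))

  ∼-refl : ∀ z → z ∼ z ≡ true
  ∼-refl z with line-through-point z
  ... | ℓ , zℓ = ∼-intro zℓ zℓ

  ∼-comm : ∀ z w → z ∼ w ≡ w ∼ z
  ∼-comm z w with z ∼ w in z∼w | w ∼ z in w∼z
  ... | true  | true  = refl
  ... | false | false = refl
  ... | true  | false = contradiction (trans (sym (∼-sym z∼w)) w∼z) λ ()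
  ... | false | true  = contradiction (trans (sym (∼-sym w∼z)) z∼w) λ ()

  C-sym : ∀ z w → C z w ≡ C w z
  C-sym z w = cong ⟦_⟧ (∼-comm z w)

  C-refl : ∀ z → C z z ≡ 1
  C-refl z = cong ⟦_⟧ (∼-refl z)

  collinear-on-line : ∀ p ℓ → ∑[ q < N ] (I q ℓ * C p q) ≡ 1 + s * I p ℓ
  collinear-on-line p ℓ with inc p ℓ in pℓ
  ... | false = begin
    ∑[ q < N ] (I q ℓ * C p q)       ≡⟨ sum-cong-≗ (λ q → sym (⟦∧⟧ (inc q ℓ) (p ∼ q))) ⟩
    ∑[ q < N ] ⟦ inc q ℓ ∧ p ∼ q ⟧    ≡⟨ sym (count≡∑ N _) ⟩
    count N (λ q → inc q ℓ ∧ p ∼ q)   ≡⟨ gqAxiom p ℓ refl pℓ ⟩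
    1                                 ≡⟨ cong (1 +_) (*-zeroʳ s) ⟨
    1 + s * 0                         ∎
    where open ≡-Reasoning
  ... | true = begin
    ∑[ q < N ] (I q ℓ * C p q)  ≡⟨ sum-cong-≗ on-ℓ ⟩
    ∑[ q < N ] I q ℓ            ≡⟨ trans (points-on ℓ) (+-comm s 1) ⟩
    1 + s                       ≡⟨ cong (1 +_) (*-identityʳ s) ⟨
    1 + s * 1                   ∎
    where
    open ≡-Reasoning
    on-ℓ : ∀ q → I q ℓ * C p q ≡ I q ℓ
    on-ℓ q with inc q ℓ in qℓ
    ... | true  = cong (_+ 0) (cong ⟦_⟧ (∼-intro pℓ qℓ))
    ... | false = refl

  unique-collinear-on-line : ∀ {a u v ℓ} → inc a ℓ ≡ false → inc u ℓ ≡ true → inc v ℓ ≡ true →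
                      a ∼ u ≡ true → a ∼ v ≡ true → u ≡ v
  unique-collinear-on-line {a} {u} {v} {ℓ} aℓ uℓ vℓ a∼u a∼v with u ≟ v
  ... | yes u≡v = u≡v
  ... | no  u≢v = contradiction (begin
    2                                  ≡⟨ cong₂ _+_ (⟦⟧*⟦⟧≡1 uℓ a∼u) (⟦⟧*⟦⟧≡1 vℓ a∼v) ⟨
    I u ℓ * C a u + I v ℓ * C a v      ≤⟨ f+f≤∑ (λ q → I q ℓ * C a q) u≢v ⟩
    ∑[ q < N ] (I q ℓ * C a q)         ≡⟨ collinear-on-line a ℓ ⟩
    1 + s * I a ℓ                      ≡⟨ cong (λ x → 1 + s * ⟦ x ⟧) aℓ ⟩
    1 + s * 0                          ≡⟨ cong suc (*-zeroʳ s) ⟩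
    1                                  ∎) (1+n≰n {1})
    where open ≤-Reasoning

  common-lines : ∀ z w → ∑[ ℓ < L ] (I z ℓ * I w ℓ) ≡ C z w + t * δ z w
  common-lines z w with z ≟ w
  ... | yes refl = begin
    ∑[ ℓ < L ] (I z ℓ * I z ℓ)  ≡⟨ sum-cong-≗ (λ ℓ → ⟦⟧*⟦⟧≡⟦⟧ (inc z ℓ)) ⟩
    ∑[ ℓ < L ] I z ℓ            ≡⟨ trans (lines-through z) (+-comm t 1) ⟩
    1 + t                       ≡⟨ cong (1 +_) (*-identityʳ t) ⟨
    1 + t * 1                   ≡⟨ cong (_+ t * 1) (C-refl z) ⟨
    C z z + t * 1               ∎
    where open ≡-Reasoning
  ... | no z≢w with z ∼ w in z∼w
  ...   | false = begin
    ∑[ ℓ < L ] (I z ℓ * I w ℓ)  ≡⟨ ∑-zero L _ (λ ℓ → ⟦⟧*⟦⟧≡0 (λ zℓ wℓ → contradiction (trans (sym (∼-intro zℓ wℓ)) z∼w) λ ())) ⟩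
    0                           ≡⟨ *-zeroʳ t ⟨
    t * 0                       ∎
    where open ≡-Reasoning
  ...   | true with ∼-elim z∼w
  ...     | ℓ₀ , zℓ₀ , wℓ₀ = begin
    ∑[ ℓ < L ] (I z ℓ * I w ℓ)  ≡⟨ ∑-single _ ℓ₀ (λ ℓ ℓ≢ℓ₀ → ⟦⟧*⟦⟧≡0 (λ zℓ wℓ → ℓ≢ℓ₀ (oneLine z w ℓ ℓ₀ refl refl z≢w zℓ wℓ zℓ₀ wℓ₀))) ⟩
    I z ℓ₀ * I w ℓ₀             ≡⟨ ⟦⟧*⟦⟧≡1 zℓ₀ wℓ₀ ⟩
    1                           ≡⟨ cong suc (*-zeroʳ t) ⟨
    1 + t * 0                   ∎
    where open ≡-Reasoning

  collinear-with-both : ∀ {a u ℓ} → a ≢ u → inc a ℓ ≡ true → inc u ℓ ≡ true →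
                   ∀ z → C a z * C u z ≡ I z ℓ
  collinear-with-both {a} {u} {ℓ} a≢u aℓ uℓ z with inc z ℓ in zℓ
  ... | true  = ⟦⟧*⟦⟧≡1 (∼-intro aℓ zℓ) (∼-intro uℓ zℓ)
  ... | false = ⟦⟧*⟦⟧≡0 (λ a∼z u∼z → a≢u (unique-collinear-on-line zℓ aℓ uℓ (∼-sym a∼z) (∼-sym u∼z)))

  line-through-pair : ∀ {a u} → a ≢ u → a ∼ u ≡ true →
                      ∃ λ ℓ → inc u ℓ ≡ true × (∀ z → C a z * C u z ≡ I z ℓ)
  line-through-pair a≢u a∼u with ∼-elim a∼u
  ... | ℓ , aℓ , uℓ = ℓ , uℓ , collinear-with-both a≢u aℓ uℓ

  ∑-δ : ∀ (g : Fin N → ℕ) u → ∑[ z < N ] (g z * δ u z) ≡ g u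
  ∑-δ g u = begin
    ∑[ z < N ] (g z * δ u z)  ≡⟨ ∑-single _ u (λ z z≢u → trans (cong (g z *_) (δ-≢ (z≢u ∘ sym))) (*-zeroʳ (g z))) ⟩
    g u * δ u u               ≡⟨ cong (g u *_) (δ-refl u) ⟩
    g u * 1                   ≡⟨ *-identityʳ (g u) ⟩
    g u                       ∎
    where open ≡-Reasoning

  perp-sum-by-lines : ∀ (g : Fin N → ℕ) u →
    ∑[ z < N ] (g z * C u z) + t * g u ≡ ∑[ ℓ < L ] (I u ℓ * ∑[ z < N ] (I z ℓ * g z))
  perp-sum-by-lines g u = begin
    ∑[ z < N ] (g z * C u z) + t * g u
      ≡⟨ cong (λ x → ∑[ z < N ] (g z * C u z) + t * x) (∑-δ g u) ⟨
    ∑[ z < N ] (g z * C u z) + t * ∑[ z < N ] (g z * δ u z)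
      ≡⟨ cong (∑[ z < N ] (g z * C u z) +_) (*-distribˡ-sum {N} t _) ⟩
    ∑[ z < N ] (g z * C u z) + ∑[ z < N ] (t * (g z * δ u z))
      ≡⟨ ∑-distrib-+ {N} _ _ ⟨
    ∑[ z < N ] (g z * C u z + t * (g z * δ u z))
      ≡⟨ sum-cong-≗ (λ z → trans (collect (g z) (C u z) t (δ u z)) (cong (g z *_) (sym (common-lines u z)))) ⟩
    ∑[ z < N ] (g z * ∑[ ℓ < L ] (I u ℓ * I z ℓ))
      ≡⟨ sum-cong-≗ (λ z → *-distribˡ-sum {L} (g z) _) ⟩
    ∑[ z < N ] ∑[ ℓ < L ] (g z * (I u ℓ * I z ℓ))
      ≡⟨ ∑-comm (λ z ℓ → g z * (I u ℓ * I z ℓ)) ⟩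
    ∑[ ℓ < L ] ∑[ z < N ] (g z * (I u ℓ * I z ℓ))
      ≡⟨ sum-cong-≗ (λ ℓ → trans (sum-cong-≗ (λ z → pull-out (g z) (I u ℓ) (I z ℓ))) (sym (*-distribˡ-sum {N} (I u ℓ) _))) ⟩
    ∑[ ℓ < L ] (I u ℓ * ∑[ z < N ] (I z ℓ * g z))
      ∎
    where
    open ≡-Reasoning
    collect : ∀ g c t d → g * c + t * (g * d) ≡ g * (c + t * d)
    collect = solve-∀
    pull-out : ∀ g i j → g * (i * j) ≡ i * (j * g)
    pull-out = solve-∀

  common-neighbours : ∀ u v → ∑[ z < N ] (C v z * C u z) + t * C v u ≡ t + 1 + s * (C u v + t * δ u v)
  common-neighbours u v = begin
    ∑[ z < N ] (C v z * C u z) + t * C v u       ≡⟨ perp-sum-by-lines (C v) u ⟩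
    ∑[ ℓ < L ] (I u ℓ * ∑[ z < N ] (I z ℓ * C v z)) ≡⟨ sum-cong-≗ (λ ℓ → cong (I u ℓ *_) (collinear-on-line v ℓ)) ⟩
    ∑[ ℓ < L ] (I u ℓ * (1 + s * I v ℓ))         ≡⟨ sum-cong-≗ (λ ℓ → spread (I u ℓ) s (I v ℓ)) ⟩
    ∑[ ℓ < L ] (I u ℓ + s * (I u ℓ * I v ℓ))     ≡⟨ ∑-distrib-+ {L} _ _ ⟩
    ∑[ ℓ < L ] I u ℓ + ∑[ ℓ < L ] (s * (I u ℓ * I v ℓ))
      ≡⟨ cong₂ _+_ (lines-through u) (sym (*-distribˡ-sum {L} s _)) ⟩
    t + 1 + s * ∑[ ℓ < L ] (I u ℓ * I v ℓ)        ≡⟨ cong (λ x → t + 1 + s * x) (common-lines u v) ⟩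
    t + 1 + s * (C u v + t * δ u v)              ∎
    where
    open ≡-Reasoning
    spread : ∀ i s j → i * (1 + s * j) ≡ i + s * (i * j)
    spread = solve-∀

  HasLineSums : (Fin N → ℕ) → ℕ → Set
  HasLineSums g G = ∀ ℓ → ∑[ z < N ] (I z ℓ * g z) ≡ G

  perp-sum : ∀ {g G} → HasLineSums g G → ∀ u → ∑[ z < N ] (g z * C u z) + t * g u ≡ (t + 1) * G
  perp-sum {g} {G} g-lines u = begin
    ∑[ z < N ] (g z * C u z) + t * g u              ≡⟨ perp-sum-by-lines g u ⟩
    ∑[ ℓ < L ] (I u ℓ * ∑[ z < N ] (I z ℓ * g z))   ≡⟨ sum-cong-≗ (λ ℓ → cong (I u ℓ *_) (g-lines ℓ)) ⟩
    ∑[ ℓ < L ] (I u ℓ * G)                          ≡⟨ *-distribʳ-sum G (I u) ⟨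
    ∑[ ℓ < L ] I u ℓ * G                            ≡⟨ cong (_* G) (lines-through u) ⟩
    (t + 1) * G                                     ∎
    where open ≡-Reasoning

  ∑-collinear-on-line : ∀ (g : Fin N → ℕ) ℓ →
    ∑[ z < N ] (g z * (1 + s * I z ℓ)) ≡ ∑[ q < N ] (I q ℓ * ∑[ z < N ] (g z * C q z))
  ∑-collinear-on-line g ℓ = begin
    ∑[ z < N ] (g z * (1 + s * I z ℓ))               ≡⟨ sum-cong-≗ (λ z → cong (g z *_) (collinear-on-line z ℓ)) ⟨
    ∑[ z < N ] (g z * ∑[ q < N ] (I q ℓ * C z q))    ≡⟨ sum-cong-≗ (λ z → *-distribˡ-sum {N} (g z) _) ⟩
    ∑[ z < N ] ∑[ q < N ] (g z * (I q ℓ * C z q))    ≡⟨ ∑-comm (λ z q → g z * (I q ℓ * C z q)) ⟩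
    ∑[ q < N ] ∑[ z < N ] (g z * (I q ℓ * C z q))    ≡⟨ sum-cong-≗ (λ q → trans (sum-cong-≗ (λ z → rearrange z q))
                                                                             (sym (*-distribˡ-sum {N} (I q ℓ) _))) ⟩
    ∑[ q < N ] (I q ℓ * ∑[ z < N ] (g z * C q z))    ∎
    where
    open ≡-Reasoning
    rearrange : ∀ z q → g z * (I q ℓ * C z q) ≡ I q ℓ * (g z * C q z)
    rearrange z q = trans (swap (g z) (I q ℓ) (C z q)) (cong (λ c → I q ℓ * (g z * c)) (C-sym z q))
      where
      swap : ∀ a b c → a * (b * c) ≡ b * (a * c)
      swap = solve-∀

  total-sum : ∀ {g G} → HasLineSums g G → Fin L → ∑[ z < N ] g z ≡ (1 + s * t) * G
  total-sum {g} {G} g-lines ℓ = +-cancelʳ-≡ ((s + t) * G) _ _ (begin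
    ∑[ z < N ] g z + (s + t) * G
      ≡⟨ split (∑[ z < N ] g z) s t G ⟩
    ∑[ z < N ] g z + s * G + t * G
      ≡⟨ cong (λ x → ∑[ z < N ] g z + s * x + t * x) (g-lines ℓ) ⟨
    ∑[ z < N ] g z + s * ∑[ z < N ] (I z ℓ * g z) + t * ∑[ z < N ] (I z ℓ * g z)
      ≡⟨ cong (λ x → x + t * ∑[ z < N ] (I z ℓ * g z)) weighted ⟩
    ∑[ z < N ] (g z * (1 + s * I z ℓ)) + t * ∑[ q < N ] (I q ℓ * g q)
      ≡⟨ cong₂ _+_ (∑-collinear-on-line g ℓ) (*-distribˡ-sum {N} t _) ⟩
    ∑[ q < N ] (I q ℓ * ∑[ z < N ] (g z * C q z)) + ∑[ q < N ] (t * (I q ℓ * g q))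
      ≡⟨ ∑-distrib-+ {N} _ _ ⟨
    ∑[ q < N ] (I q ℓ * ∑[ z < N ] (g z * C q z) + t * (I q ℓ * g q))
      ≡⟨ sum-cong-≗ (λ q → trans (factor (I q ℓ) _ t (g q)) (cong (I q ℓ *_) (perp-sum g-lines q))) ⟩
    ∑[ q < N ] (I q ℓ * ((t + 1) * G))
      ≡⟨ *-distribʳ-sum ((t + 1) * G) (λ q → I q ℓ) ⟨
    ∑[ q < N ] I q ℓ * ((t + 1) * G)
      ≡⟨ cong (_* ((t + 1) * G)) (points-on ℓ) ⟩
    (s + 1) * ((t + 1) * G)
      ≡⟨ expand s t G ⟩
    (1 + s * t) * G + (s + t) * G
      ∎)
    where
    open ≡-Reasoning
    split : ∀ a s t G → a + (s + t) * G ≡ a + s * G + t * G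
    split = solve-∀
    factor : ∀ i a t b → i * a + t * (i * b) ≡ i * (a + t * b)
    factor = solve-∀
    expand : ∀ s t G → (s + 1) * ((t + 1) * G) ≡ (1 + s * t) * G + (s + t) * G
    expand = solve-∀
    weighted : ∑[ z < N ] g z + s * ∑[ z < N ] (I z ℓ * g z) ≡ ∑[ z < N ] (g z * (1 + s * I z ℓ))
    weighted = begin
      ∑[ z < N ] g z + s * ∑[ z < N ] (I z ℓ * g z)     ≡⟨ cong (∑[ z < N ] g z +_) (*-distribˡ-sum {N} s _) ⟩
      ∑[ z < N ] g z + ∑[ z < N ] (s * (I z ℓ * g z))   ≡⟨ ∑-distrib-+ {N} _ _ ⟨
      ∑[ z < N ] (g z + s * (I z ℓ * g z))              ≡⟨ sum-cong-≗ (λ z → spread (g z) s (I z ℓ)) ⟩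
      ∑[ z < N ] (g z * (1 + s * I z ℓ))                ∎
      where
      spread : ∀ g s i → g + s * (i * g) ≡ g * (1 + s * i)
      spread = solve-∀

  1-has-line-sums : HasLineSums (λ _ → 1) (s + 1)
  1-has-line-sums ℓ = trans (sum-cong-≗ (λ z → *-identityʳ (I z ℓ))) (points-on ℓ)

  perp-size : ∀ u → ∑[ z < N ] C u z ≡ 1 + s + s * t
  perp-size u = +-cancelʳ-≡ t _ _ (begin
    ∑[ z < N ] C u z + t            ≡⟨ cong₂ _+_ (sum-cong-≗ (λ z → *-identityˡ (C u z))) (*-identityʳ t) ⟨
    ∑[ z < N ] (1 * C u z) + t * 1  ≡⟨ perp-sum 1-has-line-sums u ⟩
    (t + 1) * (s + 1)               ≡⟨ expand s t ⟩
    1 + s + s * t + t               ∎)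
    where
    open ≡-Reasoning
    expand : ∀ s t → (t + 1) * (s + 1) ≡ 1 + s + s * t + t
    expand = solve-∀

  no-triangle : ∀ {a b c} → a ≢ b → a ∼ b ≡ true → b ∼ c ≡ true → a ∼ c ≡ true →
                T (any (λ ℓ → inc a ℓ ∧ inc b ℓ ∧ inc c ℓ) (allFin L))
  no-triangle {a} {b} {c} a≢b a∼b b∼c a∼c with ∼-elim a∼b
  ... | ℓ , aℓ , bℓ with inc c ℓ in cℓ
  ...   | true  = any-allFin⁺ (λ ℓ → inc a ℓ ∧ inc b ℓ ∧ inc c ℓ) ℓ (cong₂ _∧_ aℓ (cong₂ _∧_ bℓ cℓ))
  ...   | false = contradiction (unique-collinear-on-line cℓ aℓ bℓ (∼-sym a∼c) (∼-sym b∼c)) a≢b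

  pointsOn≡∑ : ∀ H ℓ → pointsOn (restrictGeometry N L inc H) ℓ ≡ ∑[ z < N ] (I z ℓ * ⟦ H z ⟧)
  pointsOn≡∑ H ℓ = trans (count≡∑ N _) (sum-cong-≗ (λ z → trans (⟦∧⟧ (H z) (inc z ℓ)) (*-comm ⟦ H z ⟧ (I z ℓ))))

  module Centres {p q : Fin N} (p≢q : p ≢ q) (p≁q : p ∼ q ≡ false) where

    X : Fin N → Bool
    X z = p ∼ z ∧ q ∼ z

    q≁p : q ∼ p ≡ false
    q≁p = trans (∼-comm q p) p≁q

    X-size : ∑[ z < N ] ⟦ X z ⟧ ≡ t + 1
    X-size = begin
      ∑[ z < N ] ⟦ X z ⟧                      ≡⟨ +-identityʳ _ ⟨
      ∑[ z < N ] ⟦ X z ⟧ + 0                  ≡⟨ cong₂ _+_ (sum-cong-≗ (λ z → ⟦∧⟧ (p ∼ z) (q ∼ z))) (sym (*-zeroʳ t)) ⟩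
      ∑[ z < N ] (C p z * C q z) + t * 0      ≡⟨ cong (λ c → ∑[ z < N ] (C p z * C q z) + t * ⟦ c ⟧) p≁q ⟨
      ∑[ z < N ] (C p z * C q z) + t * C p q  ≡⟨ common-neighbours q p ⟩
      t + 1 + s * (C q p + t * δ q p)         ≡⟨ cong₂ (λ c d → t + 1 + s * (⟦ c ⟧ + t * d)) q≁p (δ-≢ (p≢q ∘ sym)) ⟩
      t + 1 + s * (0 + t * 0)                 ≡⟨ cong (λ x → t + 1 + s * x) (*-zeroʳ t) ⟩
      t + 1 + s * 0                           ≡⟨ cong (t + 1 +_) (*-zeroʳ s) ⟩
      t + 1 + 0                               ≡⟨ +-identityʳ _ ⟩
      t + 1                                   ∎
      where open ≡-Reasoning

    p∼X : ∀ {u} → X u ≡ true → p ∼ u ≡ true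
    p∼X {u} = ∧-conicalˡ (p ∼ u) (q ∼ u)

    q∼X : ∀ {u} → X u ≡ true → q ∼ u ≡ true
    q∼X {u} = ∧-conicalʳ (p ∼ u) (q ∼ u)

    p∉X : ∀ {u} → X u ≡ true → p ≢ u
    p∉X Xu refl = contradiction (trans (sym (q∼X Xu)) q≁p) λ ()

    q∉X : ∀ {u} → X u ≡ true → q ≢ u
    q∉X Xu refl = contradiction (trans (sym (p∼X Xu)) p≁q) λ ()

    X-coclique : ∀ {u v} → X u ≡ true → X v ≡ true → u ∼ v ≡ true → u ≡ v
    X-coclique Xu Xv u∼v with ∼-elim u∼v
    ... | ℓ , uℓ , vℓ with inc p ℓ in pℓ
    ...   | false = unique-collinear-on-line pℓ uℓ vℓ (p∼X Xu) (p∼X Xv)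
    ...   | true with inc q ℓ in qℓ
    ...     | false = unique-collinear-on-line qℓ uℓ vℓ (q∼X Xu) (q∼X Xv)
    ...     | true  = contradiction (trans (sym (∼-intro pℓ qℓ)) p≁q) λ ()

    τ : Fin N → ℕ
    τ z = ∑[ u < N ] (⟦ X u ⟧ * C u z)

    τ-on-X : ∀ {z} → X z ≡ true → τ z ≡ 1
    τ-on-X {z} Xz = trans (∑-single _ z off-z) (⟦⟧*⟦⟧≡1 Xz (∼-refl z))
      where
      off-z : ∀ u → u ≢ z → ⟦ X u ⟧ * C u z ≡ 0
      off-z u u≢z = ⟦⟧*⟦⟧≡0 (λ Xu u∼z → u≢z (X-coclique Xu Xz u∼z))

    ∑-τ : ∀ (w : Fin N → ℕ) → ∑[ z < N ] (w z * τ z) ≡ ∑[ u < N ] (⟦ X u ⟧ * ∑[ z < N ] (w z * C u z))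
    ∑-τ w = begin
      ∑[ z < N ] (w z * τ z)                              ≡⟨ sum-cong-≗ (λ z → *-distribˡ-sum {N} (w z) _) ⟩
      ∑[ z < N ] ∑[ u < N ] (w z * (⟦ X u ⟧ * C u z))     ≡⟨ ∑-comm (λ z u → w z * (⟦ X u ⟧ * C u z)) ⟩
      ∑[ u < N ] ∑[ z < N ] (w z * (⟦ X u ⟧ * C u z))     ≡⟨ sum-cong-≗ (λ u → trans (sum-cong-≗ (λ z → swap (w z) ⟦ X u ⟧ (C u z)))
                                                                                   (sym (*-distribˡ-sum {N} ⟦ X u ⟧ _))) ⟩
      ∑[ u < N ] (⟦ X u ⟧ * ∑[ z < N ] (w z * C u z))     ∎
      where
      open ≡-Reasoning
      swap : ∀ a b c → a * (b * c) ≡ b * (a * c)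
      swap = solve-∀

    ∑-τ² : ∀ (w : Fin N → ℕ) → ∑[ z < N ] (w z * (τ z * τ z)) ≡
           ∑[ u < N ] (⟦ X u ⟧ * ∑[ v < N ] (⟦ X v ⟧ * ∑[ z < N ] (w z * C u z * C v z)))
    ∑-τ² w = begin
      ∑[ z < N ] (w z * (τ z * τ z))                          ≡⟨ sum-cong-≗ (λ z → *-assoc (w z) (τ z) (τ z)) ⟨
      ∑[ z < N ] (w z * τ z * τ z)                            ≡⟨ ∑-τ (λ z → w z * τ z) ⟩
      ∑[ u < N ] (⟦ X u ⟧ * ∑[ z < N ] (w z * τ z * C u z))   ≡⟨ sum-cong-≗ (λ u → cong (⟦ X u ⟧ *_) (trans
                                                                   (sum-cong-≗ (λ z → swap (w z) (τ z) (C u z)))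
                                                                   (∑-τ (λ z → w z * C u z)))) ⟩
      ∑[ u < N ] (⟦ X u ⟧ * ∑[ v < N ] (⟦ X v ⟧ * ∑[ z < N ] (w z * C u z * C v z))) ∎
      where
      open ≡-Reasoning
      swap : ∀ a b c → a * b * c ≡ a * c * b
      swap = solve-∀

    Z : Fin N → Bool
    Z z = not (p ∼ z) ∧ not (q ∼ z)

    ∑-split : ∀ (f : Fin N → ℕ) →
      ∑[ z < N ] (⟦ Z z ⟧ * f z) + ∑[ z < N ] (C p z * f z) + ∑[ z < N ] (C q z * f z) ≡
      ∑[ z < N ] f z + ∑[ z < N ] (⟦ X z ⟧ * f z)
    ∑-split f = begin
      ∑[ z < N ] (⟦ Z z ⟧ * f z) + ∑[ z < N ] (C p z * f z) + ∑[ z < N ] (C q z * f z)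
        ≡⟨ cong (_+ ∑[ z < N ] (C q z * f z)) (∑-distrib-+ {N} _ _) ⟨
      ∑[ z < N ] (⟦ Z z ⟧ * f z + C p z * f z) + ∑[ z < N ] (C q z * f z)
        ≡⟨ ∑-distrib-+ {N} _ _ ⟨
      ∑[ z < N ] (⟦ Z z ⟧ * f z + C p z * f z + C q z * f z)
        ≡⟨ sum-cong-≗ (λ z → ⟦⟧-inclusion-exclusion (p ∼ z) (q ∼ z) (f z)) ⟩
      ∑[ z < N ] (f z + ⟦ X z ⟧ * f z)
        ≡⟨ ∑-distrib-+ {N} _ _ ⟩
      ∑[ z < N ] f z + ∑[ z < N ] (⟦ X z ⟧ * f z)
        ∎
      where open ≡-Reasoning

    X-noncollinear : ∀ {u v} → X u ≡ true → X v ≡ true → v ≢ u → C u v ≡ 0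
    X-noncollinear {u} {v} Xu Xv v≢u with u ∼ v in u∼v
    ... | true  = contradiction (sym (X-coclique Xu Xv u∼v)) v≢u
    ... | false = refl

    ∑-τ-total : ∑[ z < N ] τ z ≡ (t + 1) * (1 + s + s * t)
    ∑-τ-total = begin
      ∑[ z < N ] τ z                                  ≡⟨ sum-cong-≗ (λ z → *-identityˡ (τ z)) ⟨
      ∑[ z < N ] (1 * τ z)                            ≡⟨ ∑-τ (λ _ → 1) ⟩
      ∑[ u < N ] (⟦ X u ⟧ * ∑[ z < N ] (1 * C u z))   ≡⟨ ∑-restricted-const N X _ _ (λ u _ →
                                                           trans (sum-cong-≗ (λ z → *-identityˡ (C u z))) (perp-size u)) ⟩
      ∑[ u < N ] ⟦ X u ⟧ * (1 + s + s * t)             ≡⟨ cong (_* (1 + s + s * t)) X-size ⟩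
      (t + 1) * (1 + s + s * t)                       ∎
      where open ≡-Reasoning

    ∑-τ²-total : ∑[ z < N ] (τ z * τ z) ≡ (t + 1) * (1 + s + s * t + t * (t + 1))
    ∑-τ²-total = begin
      ∑[ z < N ] (τ z * τ z)                   ≡⟨ sum-cong-≗ (λ z → *-identityˡ (τ z * τ z)) ⟨
      ∑[ z < N ] (1 * (τ z * τ z))             ≡⟨ ∑-τ² (λ _ → 1) ⟩
      ∑[ u < N ] (⟦ X u ⟧ * ∑[ v < N ] (⟦ X v ⟧ * ∑[ z < N ] (1 * C u z * C v z)))
        ≡⟨ ∑-restricted-const N X _ _ (λ u Xu → trans (∑-restricted-except X _ u X-size Xu (off-diagonal Xu))
                                                      (cong (_+ t * (t + 1)) (diagonal u))) ⟩
      ∑[ u < N ] ⟦ X u ⟧ * (1 + s + s * t + t * (t + 1))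
        ≡⟨ cong (_* (1 + s + s * t + t * (t + 1))) X-size ⟩
      (t + 1) * (1 + s + s * t + t * (t + 1))  ∎
      where
      open ≡-Reasoning
      diagonal : ∀ u → ∑[ z < N ] (1 * C u z * C u z) ≡ 1 + s + s * t
      diagonal u = trans (sum-cong-≗ (λ z → trans (cong (_* C u z) (*-identityˡ (C u z))) (⟦⟧*⟦⟧≡⟦⟧ (u ∼ z))))
                         (perp-size u)
      off-diagonal : ∀ {u} → X u ≡ true → ∀ v → X v ≡ true → v ≢ u → ∑[ z < N ] (1 * C u z * C v z) ≡ t + 1
      off-diagonal {u} Xu v Xv v≢u = +-cancelʳ-≡ (t * C u v) _ _ (begin
        ∑[ z < N ] (1 * C u z * C v z) + t * C u v  ≡⟨ cong (_+ t * C u v) (sum-cong-≗ (λ z → cong (_* C v z) (*-identityˡ (C u z)))) ⟩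
        ∑[ z < N ] (C u z * C v z) + t * C u v      ≡⟨ common-neighbours v u ⟩
        t + 1 + s * (C v u + t * δ v u)             ≡⟨ cong₂ (λ c d → t + 1 + s * (c + t * d)) (X-noncollinear Xv Xu (v≢u ∘ sym)) (δ-≢ v≢u) ⟩
        t + 1 + s * (0 + t * 0)                     ≡⟨ vanish t s ⟩
        t + 1 + t * 0                               ≡⟨ cong (λ c → t + 1 + t * c) (X-noncollinear Xu Xv v≢u) ⟨
        t + 1 + t * C u v                           ∎)
        where
        vanish : ∀ t s → t + 1 + s * (0 + t * 0) ≡ t + 1 + t * 0
        vanish = solve-∀

    module Through {a : Fin N} (a∼X : ∀ {u} → X u ≡ true → a ∼ u ≡ true)
                   (a∉X : ∀ {u} → X u ≡ true → a ≢ u) where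

      ∑-through-τ : ∀ {g G} → HasLineSums g G → ∑[ z < N ] (C a z * (g z * τ z)) ≡ (t + 1) * G
      ∑-through-τ {g} {G} g-lines = begin
        ∑[ z < N ] (C a z * (g z * τ z))                        ≡⟨ sum-cong-≗ (λ z → *-assoc (C a z) (g z) (τ z)) ⟨
        ∑[ z < N ] (C a z * g z * τ z)                          ≡⟨ ∑-τ (λ z → C a z * g z) ⟩
        ∑[ u < N ] (⟦ X u ⟧ * ∑[ z < N ] (C a z * g z * C u z)) ≡⟨ ∑-restricted-const N X _ G on-line ⟩
        ∑[ u < N ] ⟦ X u ⟧ * G                                   ≡⟨ cong (_* G) X-size ⟩
        (t + 1) * G                                             ∎
        where
        open ≡-Reasoning
        on-line : ∀ u → X u ≡ true → ∑[ z < N ] (C a z * g z * C u z) ≡ G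
        on-line u Xu with line-through-pair (a∉X Xu) (a∼X Xu)
        ... | ℓ , uℓ , on-ℓ = trans (sum-cong-≗ (λ z → trans (swap (C a z) (g z) (C u z)) (cong (_* g z) (on-ℓ z))))
                                    (g-lines ℓ)
          where
          swap : ∀ a g c → a * g * c ≡ a * c * g
          swap = solve-∀

      ∑-through-τ² : ∑[ z < N ] (C a z * (τ z * τ z)) ≡ (t + 1) * (s + 1 + t)
      ∑-through-τ² = begin
        ∑[ z < N ] (C a z * (τ z * τ z))
          ≡⟨ ∑-τ² (C a) ⟩
        ∑[ u < N ] (⟦ X u ⟧ * ∑[ v < N ] (⟦ X v ⟧ * ∑[ z < N ] (C a z * C u z * C v z)))
          ≡⟨ ∑-restricted-const N X _ _ on-line ⟩
        ∑[ u < N ] ⟦ X u ⟧ * (s + 1 + t)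
          ≡⟨ cong (_* (s + 1 + t)) X-size ⟩
        (t + 1) * (s + 1 + t)
          ∎
        where
        open ≡-Reasoning
        on-line : ∀ u → X u ≡ true → ∑[ v < N ] (⟦ X v ⟧ * ∑[ z < N ] (C a z * C u z * C v z)) ≡ s + 1 + t
        on-line u Xu with line-through-pair (a∉X Xu) (a∼X Xu)
        ... | ℓ , uℓ , on-ℓ = begin
          ∑[ v < N ] (⟦ X v ⟧ * ∑[ z < N ] (C a z * C u z * C v z))
            ≡⟨ ∑-restricted-cong N X (λ v _ → trans (sum-cong-≗ (λ z → cong (_* C v z) (on-ℓ z))) (collinear-on-line v ℓ)) ⟩
          ∑[ v < N ] (⟦ X v ⟧ * (1 + s * I v ℓ))
            ≡⟨ ∑-restricted-except X _ u X-size Xu (λ v Xv v≢u → cong (λ i → 1 + s * i) (off-ℓ v Xv v≢u)) ⟩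
          1 + s * I u ℓ + t * (1 + s * 0)
            ≡⟨ cong (λ i → 1 + s * ⟦ i ⟧ + t * (1 + s * 0)) uℓ ⟩
          1 + s * 1 + t * (1 + s * 0)
            ≡⟨ simplify s t ⟩
          s + 1 + t
            ∎
          where
          off-ℓ : ∀ v → X v ≡ true → v ≢ u → I v ℓ ≡ 0
          off-ℓ v Xv v≢u with inc v ℓ in vℓ
          ... | true  = contradiction (X-coclique Xv Xu (∼-intro vℓ uℓ)) v≢u
          ... | false = refl
          simplify : ∀ s t → 1 + s * 1 + t * (1 + s * 0) ≡ s + 1 + t
          simplify = solve-∀

    module Through-p = Through p∼X p∉X
    module Through-q = Through q∼X q∉X

-- Triads in a generalised quadrangle of order (s, s²)

module Triad {r N L : ℕ} {inc : Fin N → Fin L → Bool}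
             (gq : IsGQ (fullGeometry N L inc) (suc r) (suc r * suc r)) where
  open Quadrangle gq

  private
    s t K : ℕ
    s = suc r
    t = s * s
    K = 1 + s + s * t

  module _ {p q : Fin N} (p≢q : p ≢ q) (p≁q : p ∼ q ≡ false) where
    open Centres p≢q p≁q

    private
      some-line : Fin L
      some-line = proj₁ (line-through-point p)

      ∑-*1 : ∀ (f : Fin N → ℕ) → ∑[ z < N ] (f z * 1) ≡ ∑[ z < N ] f z
      ∑-*1 f = sum-cong-≗ (λ z → *-identityʳ (f z))

      ∑-1* : ∀ (f : Fin N → ℕ) → ∑[ z < N ] (f z * (1 * τ z)) ≡ ∑[ z < N ] (f z * τ z)
      ∑-1* f = sum-cong-≗ (λ z → cong (f z *_) (*-identityˡ (τ z)))

      cancel-twice : ∀ {x y} a → x + a + a ≡ y + a + a → x ≡ y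
      cancel-twice a eq = +-cancelʳ-≡ a _ _ (+-cancelʳ-≡ a _ _ eq)

    -- Over Z, τ has the mean and the second moment of the constant s + 1.
    ∑-Z : ∑[ z < N ] ⟦ Z z ⟧ ≡ s * r * (t + 1)
    ∑-Z = cancel-twice K (begin
      ∑[ z < N ] ⟦ Z z ⟧ + K + K
        ≡⟨ cong₂ _+_ (cong₂ _+_ (∑-*1 (λ z → ⟦ Z z ⟧)) (trans (∑-*1 (C p)) (perp-size p)))
                     (trans (∑-*1 (C q)) (perp-size q)) ⟨
      ∑[ z < N ] (⟦ Z z ⟧ * 1) + ∑[ z < N ] (C p z * 1) + ∑[ z < N ] (C q z * 1)
        ≡⟨ ∑-split (λ _ → 1) ⟩
      ∑[ z < N ] 1 + ∑[ z < N ] (⟦ X z ⟧ * 1)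
        ≡⟨ cong₂ _+_ (total-sum 1-has-line-sums some-line) (trans (∑-*1 (λ z → ⟦ X z ⟧)) X-size) ⟩
      (1 + s * t) * (s + 1) + (t + 1)
        ≡⟨ identity r ⟩
      s * r * (t + 1) + K + K
        ∎)
      where
      open ≡-Reasoning
      identity : ∀ r → let s = suc r ; t = s * s ; K = 1 + s + s * t in
                 (1 + s * t) * (s + 1) + (t + 1) ≡ s * r * (t + 1) + K + K
      identity = solve-∀

    ∑-Z-τ : ∑[ z < N ] (⟦ Z z ⟧ * τ z) ≡ (s + 1) * (s * r * (t + 1))
    ∑-Z-τ = cancel-twice ((t + 1) * (s + 1)) (begin
      ∑[ z < N ] (⟦ Z z ⟧ * τ z) + (t + 1) * (s + 1) + (t + 1) * (s + 1)
        ≡⟨ cong₂ _+_ (cong₂ _+_ (∑-1* (λ z → ⟦ Z z ⟧)) (Through-p.∑-through-τ 1-has-line-sums))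
                     (Through-q.∑-through-τ 1-has-line-sums) ⟨
      ∑[ z < N ] (⟦ Z z ⟧ * (1 * τ z)) + ∑[ z < N ] (C p z * (1 * τ z)) + ∑[ z < N ] (C q z * (1 * τ z))
        ≡⟨ ∑-split (λ z → 1 * τ z) ⟩
      ∑[ z < N ] (1 * τ z) + ∑[ z < N ] (⟦ X z ⟧ * (1 * τ z))
        ≡⟨ cong₂ _+_ (trans (sum-cong-≗ (λ z → *-identityˡ (τ z))) ∑-τ-total)
                     (trans (∑-1* (λ z → ⟦ X z ⟧)) (trans (∑-restricted-const N X τ 1 (λ z → τ-on-X)) (cong (_* 1) X-size))) ⟩
      (t + 1) * K + (t + 1) * 1
        ≡⟨ identity r ⟩
      (s + 1) * (s * r * (t + 1)) + (t + 1) * (s + 1) + (t + 1) * (s + 1)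
        ∎)
      where
      open ≡-Reasoning
      identity : ∀ r → let s = suc r ; t = s * s ; K = 1 + s + s * t in
                 (t + 1) * K + (t + 1) * 1 ≡ (s + 1) * (s * r * (t + 1)) + (t + 1) * (s + 1) + (t + 1) * (s + 1)
      identity = solve-∀

    ∑-Z-τ² : ∑[ z < N ] (⟦ Z z ⟧ * (τ z * τ z)) ≡ (s + 1) * (s + 1) * (s * r * (t + 1))
    ∑-Z-τ² = cancel-twice ((t + 1) * (s + 1 + t)) (begin
      ∑[ z < N ] (⟦ Z z ⟧ * (τ z * τ z)) + (t + 1) * (s + 1 + t) + (t + 1) * (s + 1 + t)
        ≡⟨ cong₂ _+_ (cong (∑[ z < N ] (⟦ Z z ⟧ * (τ z * τ z)) +_) Through-p.∑-through-τ²) Through-q.∑-through-τ² ⟨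
      ∑[ z < N ] (⟦ Z z ⟧ * (τ z * τ z)) + ∑[ z < N ] (C p z * (τ z * τ z)) + ∑[ z < N ] (C q z * (τ z * τ z))
        ≡⟨ ∑-split (λ z → τ z * τ z) ⟩
      ∑[ z < N ] (τ z * τ z) + ∑[ z < N ] (⟦ X z ⟧ * (τ z * τ z))
        ≡⟨ cong₂ _+_ ∑-τ²-total (trans (∑-restricted-const N X _ 1 (λ z Xz → cong₂ _*_ (τ-on-X Xz) (τ-on-X Xz)))
                                       (cong (_* 1) X-size)) ⟩
      (t + 1) * (K + t * (t + 1)) + (t + 1) * 1
        ≡⟨ identity r ⟩
      (s + 1) * (s + 1) * (s * r * (t + 1)) + (t + 1) * (s + 1 + t) + (t + 1) * (s + 1 + t)
        ∎)
      where
      open ≡-Reasoning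
      identity : ∀ r → let s = suc r ; t = s * s ; K = 1 + s + s * t in
                 (t + 1) * (K + t * (t + 1)) + (t + 1) * 1 ≡
                 (s + 1) * (s + 1) * (s * r * (t + 1)) + (t + 1) * (s + 1 + t) + (t + 1) * (s + 1 + t)
      identity = solve-∀

    triad : ∀ {z} → Z z ≡ true → τ z ≡ s + 1
    triad {z} = zero-variance⇒constant N Z τ (s + 1) variance z
      where
      variance : ∑[ z < N ] (⟦ Z z ⟧ * (τ z * τ z)) + (s + 1) * (s + 1) * ∑[ z < N ] ⟦ Z z ⟧ ≡
                 2 * (s + 1) * ∑[ z < N ] (⟦ Z z ⟧ * τ z)
      variance = begin
        ∑[ z < N ] (⟦ Z z ⟧ * (τ z * τ z)) + (s + 1) * (s + 1) * ∑[ z < N ] ⟦ Z z ⟧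
          ≡⟨ cong₂ (λ a b → a + (s + 1) * (s + 1) * b) ∑-Z-τ² ∑-Z ⟩
        (s + 1) * (s + 1) * W + (s + 1) * (s + 1) * W
          ≡⟨ identity (s + 1) W ⟩
        2 * (s + 1) * ((s + 1) * W)
          ≡⟨ cong (2 * (s + 1) *_) ∑-Z-τ ⟨
        2 * (s + 1) * ∑[ z < N ] (⟦ Z z ⟧ * τ z)
          ∎
        where
        open ≡-Reasoning
        W = s * r * (t + 1)
        identity : ∀ c W → c * c * W + c * c * W ≡ 2 * c * (c * W)
        identity = solve-∀

-- Hemisystems

module Hemisystem {m N L : ℕ} {inc : Fin N → Fin L → Bool}
                  (gq : IsGQ (fullGeometry N L inc) (1 + 2 * m) ((1 + 2 * m) * (1 + 2 * m)))
                  (H : Fin N → Bool)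
                  (H-lines : Quadrangle.HasLineSums gq (λ z → ⟦ H z ⟧) (1 + m)) where
  open Quadrangle gq
  open Triad gq using (triad)

  private
    s t k : ℕ
    s = 1 + 2 * m
    t = s * s
    k = 1 + m

  H-perp : ∀ {a} → H a ≡ true → ∑[ z < N ] (C a z * ⟦ H z ⟧) ≡ 1 + (t + 1) * m
  H-perp {a} Ha = +-cancelʳ-≡ t _ _ (begin
    ∑[ z < N ] (C a z * ⟦ H z ⟧) + t          ≡⟨ cong₂ _+_ (sum-cong-≗ (λ z → *-comm (C a z) ⟦ H z ⟧)) (sym (*-identityʳ t)) ⟩
    ∑[ z < N ] (⟦ H z ⟧ * C a z) + t * 1      ≡⟨ cong (λ b → ∑[ z < N ] (⟦ H z ⟧ * C a z) + t * ⟦ b ⟧) Ha ⟨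
    ∑[ z < N ] (⟦ H z ⟧ * C a z) + t * ⟦ H a ⟧ ≡⟨ perp-sum H-lines a ⟩
    (t + 1) * k                               ≡⟨ identity t m ⟩
    1 + (t + 1) * m + t                       ∎)
    where
    open ≡-Reasoning
    identity : ∀ t m → (t + 1) * (1 + m) ≡ 1 + (t + 1) * m + t
    identity = solve-∀

  module _ {p q : Fin N} (Hp : H p ≡ true) (Hq : H q ≡ true) (p≢q : p ≢ q) (p≁q : p ∼ q ≡ false) where
    open Centres p≢q p≁q

    private
      h Zh : ℕ
      h  = ∑[ z < N ] (⟦ X z ⟧ * ⟦ H z ⟧)
      Zh = ∑[ z < N ] (⟦ Z z ⟧ * ⟦ H z ⟧)

      some-line : Fin L
      some-line = proj₁ (line-through-point p)

    split-H : Zh + (1 + (t + 1) * m + (1 + (t + 1) * m)) ≡ (1 + s * t) * k + h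
    split-H = begin
      Zh + (1 + (t + 1) * m + (1 + (t + 1) * m))
        ≡⟨ +-assoc Zh _ _ ⟨
      Zh + (1 + (t + 1) * m) + (1 + (t + 1) * m)
        ≡⟨ cong₂ _+_ (cong (Zh +_) (H-perp Hp)) (H-perp Hq) ⟨
      Zh + ∑[ z < N ] (C p z * ⟦ H z ⟧) + ∑[ z < N ] (C q z * ⟦ H z ⟧)
        ≡⟨ ∑-split (λ z → ⟦ H z ⟧) ⟩
      ∑[ z < N ] ⟦ H z ⟧ + h
        ≡⟨ cong (_+ h) (total-sum H-lines some-line) ⟩
      (1 + s * t) * k + h
        ∎
      where open ≡-Reasoning

    ∑-H-τ : ∑[ z < N ] (⟦ H z ⟧ * τ z) + t * h ≡ (t + 1) * ((t + 1) * k)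
    ∑-H-τ = begin
      ∑[ z < N ] (⟦ H z ⟧ * τ z) + t * h
        ≡⟨ cong₂ _+_ (∑-τ (λ z → ⟦ H z ⟧)) (*-distribˡ-sum {N} t _) ⟩
      ∑[ u < N ] (⟦ X u ⟧ * ∑[ z < N ] (⟦ H z ⟧ * C u z)) + ∑[ u < N ] (t * (⟦ X u ⟧ * ⟦ H u ⟧))
        ≡⟨ ∑-distrib-+ {N} _ _ ⟨
      ∑[ u < N ] (⟦ X u ⟧ * ∑[ z < N ] (⟦ H z ⟧ * C u z) + t * (⟦ X u ⟧ * ⟦ H u ⟧))
        ≡⟨ sum-cong-≗ (λ u → trans (factor ⟦ X u ⟧ _ t ⟦ H u ⟧) (cong (⟦ X u ⟧ *_) (perp-sum H-lines u))) ⟩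
      ∑[ u < N ] (⟦ X u ⟧ * ((t + 1) * k))
        ≡⟨ *-distribʳ-sum ((t + 1) * k) (λ u → ⟦ X u ⟧) ⟨
      ∑[ u < N ] ⟦ X u ⟧ * ((t + 1) * k)
        ≡⟨ cong (_* ((t + 1) * k)) X-size ⟩
      (t + 1) * ((t + 1) * k)
        ∎
      where
      open ≡-Reasoning
      factor : ∀ x a t b → x * a + t * (x * b) ≡ x * (a + t * b)
      factor = solve-∀

    split-Hτ : (s + 1) * Zh + ((t + 1) * k + (t + 1) * k) + t * h ≡ (t + 1) * ((t + 1) * k) + h
    split-Hτ = begin
      (s + 1) * Zh + ((t + 1) * k + (t + 1) * k) + t * h
        ≡⟨ cong (_+ t * h) (+-assoc ((s + 1) * Zh) _ _) ⟨
      (s + 1) * Zh + (t + 1) * k + (t + 1) * k + t * h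
        ≡⟨ cong (_+ t * h) (cong₂ _+_ (cong₂ _+_ on-Z (Through-p.∑-through-τ H-lines)) (Through-q.∑-through-τ H-lines)) ⟨
      ∑[ z < N ] (⟦ Z z ⟧ * (⟦ H z ⟧ * τ z)) + ∑[ z < N ] (C p z * (⟦ H z ⟧ * τ z)) + ∑[ z < N ] (C q z * (⟦ H z ⟧ * τ z)) + t * h
        ≡⟨ cong (_+ t * h) (∑-split (λ z → ⟦ H z ⟧ * τ z)) ⟩
      ∑[ z < N ] (⟦ H z ⟧ * τ z) + ∑[ z < N ] (⟦ X z ⟧ * (⟦ H z ⟧ * τ z)) + t * h
        ≡⟨ cong (λ x → ∑[ z < N ] (⟦ H z ⟧ * τ z) + x + t * h) on-X ⟩
      ∑[ z < N ] (⟦ H z ⟧ * τ z) + h + t * h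
        ≡⟨ swap (∑[ z < N ] (⟦ H z ⟧ * τ z)) h (t * h) ⟩
      ∑[ z < N ] (⟦ H z ⟧ * τ z) + t * h + h
        ≡⟨ cong (_+ h) ∑-H-τ ⟩
      (t + 1) * ((t + 1) * k) + h
        ∎
      where
      open ≡-Reasoning
      swap : ∀ a b c → a + b + c ≡ a + c + b
      swap = solve-∀
      on-Z : ∑[ z < N ] (⟦ Z z ⟧ * (⟦ H z ⟧ * τ z)) ≡ (s + 1) * Zh
      on-Z = begin
        ∑[ z < N ] (⟦ Z z ⟧ * (⟦ H z ⟧ * τ z))      ≡⟨ ∑-restricted-cong N Z (λ z Zz → cong (⟦ H z ⟧ *_) (triad p≢q p≁q Zz)) ⟩
        ∑[ z < N ] (⟦ Z z ⟧ * (⟦ H z ⟧ * (s + 1)))  ≡⟨ sum-cong-≗ (λ z → pull (⟦ Z z ⟧) ⟦ H z ⟧ (s + 1)) ⟩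
        ∑[ z < N ] ((s + 1) * (⟦ Z z ⟧ * ⟦ H z ⟧))  ≡⟨ *-distribˡ-sum {N} (s + 1) _ ⟨
        (s + 1) * Zh                                ∎
        where
        pull : ∀ a b c → a * (b * c) ≡ c * (a * b)
        pull = solve-∀
      on-X : ∑[ z < N ] (⟦ X z ⟧ * (⟦ H z ⟧ * τ z)) ≡ h
      on-X = ∑-restricted-cong N X (λ z Xz → trans (cong (⟦ H z ⟧ *_) (τ-on-X Xz)) (*-identityʳ ⟦ H z ⟧))

    H-centres : count N (λ z → H z ∧ z ∼ p ∧ z ∼ q) ≡ 2 * m * m
    H-centres = begin
      count N (λ z → H z ∧ z ∼ p ∧ z ∼ q)   ≡⟨ count≡∑ N _ ⟩
      ∑[ z < N ] ⟦ H z ∧ z ∼ p ∧ z ∼ q ⟧     ≡⟨ sum-cong-≗ as-product ⟩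
      h                                     ≡⟨ *-cancelˡ-≡ h (2 * m * m) (s + t) (+-cancelʳ-≡ _ _ _ eliminated) ⟩
      2 * m * m                             ∎
      where
      open ≡-Reasoning
      as-product : ∀ z → ⟦ H z ∧ z ∼ p ∧ z ∼ q ⟧ ≡ ⟦ X z ⟧ * ⟦ H z ⟧
      as-product z = begin
        ⟦ H z ∧ z ∼ p ∧ z ∼ q ⟧     ≡⟨ ⟦∧⟧ (H z) _ ⟩
        ⟦ H z ⟧ * ⟦ z ∼ p ∧ z ∼ q ⟧  ≡⟨ cong (λ b → ⟦ H z ⟧ * ⟦ b ⟧) (cong₂ _∧_ (∼-comm z p) (∼-comm z q)) ⟩
        ⟦ H z ⟧ * ⟦ X z ⟧            ≡⟨ *-comm ⟦ H z ⟧ _ ⟩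
        ⟦ X z ⟧ * ⟦ H z ⟧            ∎
      identity : ∀ m → let s = 1 + 2 * m ; t = s * s ; k = 1 + m in
        (t + 1) * ((t + 1) * k) + (s + 1) * (1 + (t + 1) * m + (1 + (t + 1) * m)) ≡
        (s + t) * (2 * m * m) + ((s + 1) * ((1 + s * t) * k) + ((t + 1) * k + (t + 1) * k))
      identity = solve-∀
      eliminated : (s + t) * h + ((s + 1) * ((1 + s * t) * k) + ((t + 1) * k + (t + 1) * k)) ≡
                   (s + t) * (2 * m * m) + ((s + 1) * ((1 + s * t) * k) + ((t + 1) * k + (t + 1) * k))
      eliminated = trans (linear-elimination s t Zh h _ _ _ _ split-H split-Hτ) (identity m)

hemisystem-isPartialQuadrangle : ∀ {m N L} {inc : Fin N → Fin L → Bool} →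
  IsGQ (fullGeometry N L inc) (1 + 2 * m) ((1 + 2 * m) * (1 + 2 * m)) →
  (H : Fin N → Bool) → (∀ ℓ → pointsOn (restrictGeometry N L inc H) ℓ ≡ 1 + m) →
  IsPartialQuadrangle (restrictGeometry N L inc H) (1 + m) ((1 + 2 * m) * (1 + 2 * m) + 1) (2 * m * m)
hemisystem-isPartialQuadrangle gq H H-lines = record
  { linePoints = H-lines
  ; pointLines = λ p _ → IsGQ.pointLines gq p refl
  ; oneLine    = λ p q ℓ ℓ′ _ _ → IsGQ.oneLine gq p q ℓ ℓ′ refl refl
  ; noTriangle = λ _ _ _ _ _ _ a≢b _ _ → no-triangle a≢b
  ; mu         = λ p q Hp Hq (p≢q , p≁q) → H-centres Hp Hq p≢q p≁q
  }
  where
  open Quadrangle gq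
  open Hemisystem gq H (λ ℓ → trans (sym (pointsOn≡∑ H ℓ)) (H-lines ℓ))

odd⇒1+2* : ∀ s → s % 2 ≡ 1 → ∃ λ m → s ≡ 1 + 2 * m
odd⇒1+2* s s-odd = s / 2 , trans (m≡m%n+[m/n]*n s 2) (cong₂ _+_ s-odd (*-comm (s / 2) 2))

[1+2*m+1]/2≡1+m : ∀ m → (1 + 2 * m + 1) / 2 ≡ 1 + m
[1+2*m+1]/2≡1+m m = trans (cong (_/ 2) (double m)) (m*n/n≡m (1 + m) 2)
  where
  double : ∀ m → 1 + 2 * m + 1 ≡ (1 + m) * 2
  double = solve-∀

[2*m*[2*m]]/2≡2*m*m : ∀ m → (2 * m * (2 * m)) / 2 ≡ 2 * m * m
[2*m*[2*m]]/2≡2*m*m m = trans (cong (_/ 2) (double m)) (m*n/n≡m (2 * m * m) 2)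
  where
  double : ∀ m → 2 * m * (2 * m) ≡ 2 * m * m * 2
  double = solve-∀

theorem5p2 : (s : ℕ) → 1 < s → s % 2 ≡ 1 →
    (np nl : ℕ) (inc : Fin np → Fin nl → Bool) →
    IsGQ (fullGeometry np nl inc) s (s * s) →
    (H : Fin np → Bool) →
    (∀ ℓ → pointsOn (restrictGeometry np nl inc H) ℓ ≡ (s + 1) / 2) →
    ∃₂ λ k r → IsPartialQuadrangle (restrictGeometry np nl inc H) k r (((s ∸ 1) * (s ∸ 1)) / 2)
theorem5p2 s _ s-odd np nl inc gq H H-lines with odd⇒1+2* s s-odd
... | m , refl = 1 + m , _ ,
  subst (IsPartialQuadrangle (restrictGeometry np nl inc H) (1 + m) _) (sym ([2*m*[2*m]]/2≡2*m*m m))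
        (hemisystem-isPartialQuadrangle gq H (λ ℓ → trans (H-lines ℓ) ([1+2*m+1]/2≡1+m m)))
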